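{- Let $s,t\in\mathbb{R}$ with $s\neq0$, $t\neq0$, $s^2+4t\neq0$. For all $d\in\mathbb{N}$, as formal power series in $y$, \[ \sum_{n=0}^{\infty}\genfrac{\{}{\}}{0pt}{}{n+d}{d}_{s,t}(-t)^{ -\binom{n+d}{2}}\left(-\frac{y}{t}\right)^n=\frac{1}{\{d\}_{s,t}!}\,\Theta_0^{(d)}\!\left(-\frac{y}{t},-\frac1t\right). \]
   Context: $\varphi_{s,t}=\frac{s+\sqrt{s^2+4t}}{2}$, $\varphi'_{s,t}=\frac{s-\sqrt{s^2+4t}}{2}$. Generalized Fibonacci polynomials: $\{0\}_{s,t}=0$, $\{1\}_{s,t}=1$, $\{n+2\}_{s,t}=s\{n+1\}_{s,t}+t\{n\}_{s,t}$; $\{k\}_{s,t}!=\{1\}_{s,t}\cdots\{k\}_{s,t}$; $\genfrac{\{}{\}}{0pt}{}{n+d}{d}_{s,t}=\frac{\{n+1\}_{s,t}\cdots\{n+d\}_{s,t}}{\{d\}_{s,t}!}$. The Partial Theta function is $\Theta_0(x,q)=\sum_{n\geq0}q^{\binom{n}{2}}x^n$, and $\Theta_0^{(d)}(x,q)=\mathbf{D}_{s,t}^d\Theta_0(x,q)$ is its $d$-fold $(s,t)$-derivative in $x$, computed termwise, where $(\mathbf{D}_{s,t}f)(x)=\frac{f(\varphi_{s,t}x)-f(\varphi'_{s,t}x)}{(\varphi_{s,t}-\varphi'_{s,t})x}$ (so $\mathbf{D}_{s,t}x^k=\{k\}_{s,t}x^{k-1}$); this is then evaluated at $x=-y/t$,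 $q=-1/t$. -}

module Defs where

open import Level using (Level; suc; _⊔_)
open import Data.Nat as ℕ using (ℕ; zero)
open import Data.Nat.Combinatorics using (_C_)
open import Algebra.Bundles using (CommutativeRing)
open import Relation.Nullary using (¬_)

-- A field: a commutative ring with 0 ≠ 1 and a total inverse operation
-- satisfying x * x⁻¹ ≈ 1 for x ≉ 0 (the value of 0⁻¹ is unconstrained).
record Field (c ℓ : Level) : Set (suc (c ⊔ ℓ)) where
  field
    commutativeRing : CommutativeRing c ℓ
  open CommutativeRing commutativeRing public
  field
    _⁻¹       : Carrier → Carrier
    inverseʳ  : ∀ x → ¬ (x ≈ 0#) → (x * x ⁻¹) ≈ 1#
    0≉1       : ¬ (0# ≈ 1#)

module FieldDefs {c ℓ : Level} (F : Field c ℓ) where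
  open Field F

  _^_ : Carrier → ℕ → Carrier
  x ^ zero = 1#
  x ^ ℕ.suc n = x * (x ^ n)

  fib : Carrier → Carrier → ℕ → Carrier
  fib s t zero = 0#
  fib s t (ℕ.suc zero) = 1#
  fib s t (ℕ.suc (ℕ.suc n)) = (s * fib s t (ℕ.suc n)) + (t * fib s t n)

  fibFact : Carrier → Carrier → ℕ → Carrier
  fibFact s t zero = 1#
  fibFact s t (ℕ.suc k) = fibFact s t k * fib s t (ℕ.suc k)

  risingFib : Carrier → Carrier → ℕ → ℕ → Carrier
  risingFib s t n zero = 1#
  risingFib s t n (ℕ.suc d) = risingFib s t n d * fib s t (n ℕ.+ ℕ.suc d)

  fibonomial : Carrier → Carrier → ℕ → ℕ → Carrier
  fibonomial s t n d = risingFib s t n d * (fibFact s t d) ⁻¹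

  -- formal power series in one variable: coefficient sequences
  Series : Set c
  Series = ℕ → Carrier

  -- (s,t)-derivative, termwise: D x^k = {k} x^(k-1)
  Dst : Carrier → Carrier → Series → Series
  Dst s t f n = fib s t (ℕ.suc n) * f (ℕ.suc n)

  Dst^ : Carrier → Carrier → ℕ → Series → Series
  Dst^ s t zero f = f
  Dst^ s t (ℕ.suc d) f = Dst s t (Dst^ s t d f)

  -- Partial theta function Θ₀(x,q) = Σ q^(n choose 2) x^n, as series in x
  -- with q specialised to a field element
  Θ₀ : Carrier → Series
  Θ₀ q n = q ^ (n C 2)

  Θ₀^ : Carrier → Carrier → ℕ → Carrier → Series
  Θ₀^ s t d q = Dst^ s t d (Θ₀ q)

  -- substitution x = c·y into a series in x, giving a series in y
  substScale : Carrier → Series → Series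
  substScale a f n = (a ^ n) * f n

  scale : Carrier → Series → Series
  scale a f n = a * f n

  _≈ₛ_ : Series → Series → Set ℓ
  f ≈ₛ g = ∀ n → f n ≈ g n

  lhsSeries : Carrier → Carrier → ℕ → Series
  lhsSeries s t d n =
    (fibonomial s t n d * (((- t) ⁻¹) ^ ((n ℕ.+ d) C 2))) * ((- (t ⁻¹)) ^ n)

  rhsSeries : Carrier → Carrier → ℕ → Series
  rhsSeries s t d =
    scale ((fibFact s t d) ⁻¹) (substScale (- (t ⁻¹)) (Θ₀^ s t d (- (t ⁻¹))))

{-# OPTIONS --safe #-}
-- Iterating the termwise (s,t)-derivative d times multiplies the coefficient
-- of x^(n+d) by {n+1}⋯{n+d} and moves it to x^n, so the n-th coefficient of
-- Θ₀^(d)(x, q) is {n+1}⋯{n+d} q^C(n+d,2).  Dividing by {d}! yields the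
-- fibonomial, and q = -1/t is (-t)⁻¹, so both sides agree coefficientwise.
module Submission where

open import Defs
open import Level using (Level)
open import Data.Nat using (ℕ; zero; suc)
import Data.Nat.Properties as ℕ
open import Data.Nat.Combinatorics using (_C_)
open import Relation.Nullary using (¬_)
import Relation.Binary.PropositionalEquality as ≡
import Relation.Binary.Reasoning.Setoid as SetoidReasoning
import Algebra.Properties.Ring as RingProperties
import Algebra.Solver.CommutativeMonoid as CommutativeMonoidSolver

module _ {c ℓ : Level} (F : Field c ℓ) where
  open Field F hiding (_+_)
  open import Data.Nat using (_+_)
  open FieldDefs F
  open SetoidReasoning setoid
  open RingProperties ring using (-‿involutive; -‿distribˡ-*; -‿distribʳ-*)

  ^-congˡ : ∀ {x y} n → x ≈ y → (x ^ n) ≈ (y ^ n)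
  ^-congˡ zero    x≈y = refl
  ^-congˡ (suc n) x≈y = *-cong x≈y (^-congˡ n x≈y)

  inverseʳ-unique : ∀ x y → (x * y) ≈ 1# → y ≈ (x ⁻¹)
  inverseʳ-unique x y xy≈1 = begin
    y                     ≈⟨ *-identityˡ y ⟨
    1# * y                ≈⟨ *-cong (inverseʳ x x≉0) refl ⟨
    (x * x ⁻¹) * y        ≈⟨ *-cong (*-comm x (x ⁻¹)) refl ⟩
    (x ⁻¹ * x) * y        ≈⟨ *-assoc (x ⁻¹) x y ⟩
    x ⁻¹ * (x * y)        ≈⟨ *-cong refl xy≈1 ⟩
    x ⁻¹ * 1#             ≈⟨ *-identityʳ (x ⁻¹) ⟩
    x ⁻¹                  ∎
    where
    x≉0 : ¬ (x ≈ 0#)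
    x≉0 x≈0 = 0≉1 (trans (sym (zeroˡ y)) (trans (*-cong (sym x≈0) refl) xy≈1))

  -‿⁻¹ : ∀ {x} → ¬ (x ≈ 0#) → ((- x) ⁻¹) ≈ (- (x ⁻¹))
  -‿⁻¹ {x} x≉0 = sym (inverseʳ-unique (- x) (- (x ⁻¹)) (begin
    (- x) * (- (x ⁻¹))    ≈⟨ -‿distribˡ-* x _ ⟨
    - (x * (- (x ⁻¹)))    ≈⟨ -‿cong (-‿distribʳ-* x _) ⟨
    - (- (x * x ⁻¹))      ≈⟨ -‿involutive _ ⟩
    x * x ⁻¹              ≈⟨ inverseʳ x x≉0 ⟩
    1#                    ∎))

  fib-*-risingFib-suc : ∀ s t n d →
    (fib s t (suc n) * risingFib s t (suc n) d)
      ≈ (risingFib s t n d * fib s t (n + suc d))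
  fib-*-risingFib-suc s t n zero = begin
    fib s t (suc n) * 1#  ≈⟨ *-comm _ 1# ⟩
    1# * fib s t (suc n)  ≡⟨ ≡.cong (λ m → 1# * fib s t m) (ℕ.+-comm 1 n) ⟩
    1# * fib s t (n + 1)  ∎
  fib-*-risingFib-suc s t n (suc d) = begin
    fib s t (suc n) * (risingFib s t (suc n) d * fib s t (suc n + suc d))
      ≈⟨ *-assoc _ _ _ ⟨
    (fib s t (suc n) * risingFib s t (suc n) d) * fib s t (suc n + suc d)
      ≈⟨ *-cong (fib-*-risingFib-suc s t n d) refl ⟩
    (risingFib s t n d * fib s t (n + suc d)) * fib s t (suc n + suc d)
      ≡⟨ ≡.cong (λ m → risingFib s t n (suc d) * fib s t m) (ℕ.+-suc n (suc d)) ⟨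
    risingFib s t n (suc d) * fib s t (n + suc (suc d))
      ∎

  Dst^-coefficient : ∀ s t d (f : Series) n →
    Dst^ s t d f n ≈ (risingFib s t n d * f (n + d))
  Dst^-coefficient s t zero f n = begin
    f n             ≈⟨ *-identityˡ (f n) ⟨
    1# * f n        ≡⟨ ≡.cong (λ m → 1# * f m) (ℕ.+-identityʳ n) ⟨
    1# * f (n + 0)  ∎
  Dst^-coefficient s t (suc d) f n = begin
    fib s t (suc n) * Dst^ s t d f (suc n)
      ≈⟨ *-cong refl (Dst^-coefficient s t d f (suc n)) ⟩
    fib s t (suc n) * (risingFib s t (suc n) d * f (suc n + d))
      ≈⟨ *-assoc _ _ _ ⟨
    (fib s t (suc n) * risingFib s t (suc n) d) * f (suc n + d)
      ≈⟨ *-cong (fib-*-risingFib-suc s t n d) refl ⟩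
    risingFib s t n (suc d) * f (suc n + d)
      ≡⟨ ≡.cong (λ m → risingFib s t n (suc d) * f m) (ℕ.+-suc n d) ⟨
    risingFib s t n (suc d) * f (n + suc d)
      ∎

  lhsSeries≈rhsSeries : ∀ s t → ¬ (t ≈ 0#) → ∀ d →
    lhsSeries s t d ≈ₛ rhsSeries s t d
  lhsSeries≈rhsSeries s t t≉0 d n = begin
    ((R * I) * (((- t) ⁻¹) ^ k)) * (q ^ n)
      ≈⟨ *-cong (*-cong refl (^-congˡ k (-‿⁻¹ t≉0))) refl ⟩
    ((R * I) * (q ^ k)) * (q ^ n)
      ≈⟨ solve 4 (λ R I X Y → ((R ⊕ I) ⊕ X) ⊕ Y ⊜ I ⊕ (Y ⊕ (R ⊕ X)))
               refl R I (q ^ k) (q ^ n) ⟩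
    I * ((q ^ n) * (R * Θ₀ q (n + d)))
      ≈⟨ *-cong refl (*-cong refl (Dst^-coefficient s t d (Θ₀ q) n)) ⟨
    I * ((q ^ n) * Dst^ s t d (Θ₀ q) n)
      ∎
    where
    open CommutativeMonoidSolver *-commutativeMonoid using (solve; _⊕_; _⊜_)
    R = risingFib s t n d
    I = fibFact s t d ⁻¹
    q = - (t ⁻¹)
    k = (n + d) C 2

-- s ≉ 0 and s² + 4t ≉ 0 only serve to make φ ≠ φ′ in the q-difference form
-- of 𝐃_{s,t}.
mainTheorem16 : ∀ {c ℓ : Level} (F : Field c ℓ) →
    let open Field F
        open FieldDefs F
    in
    (s t : Carrier) → ¬ (s ≈ 0#) → ¬ (t ≈ 0#) →
    ¬ (((s * s) + ((1# + 1# + 1# + 1#) * t)) ≈ 0#) →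
    (d : ℕ) → lhsSeries s t d ≈ₛ rhsSeries s t d
mainTheorem16 F s t _ t≉0 _ = lhsSeries≈rhsSeries F s t t≉0
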